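{- Let $p$ be an odd prime and let $k$ be an even positive integer with prime factorization $k=2^{\alpha_0}q_1^{\alpha_1}\cdots q_\ell^{\alpha_\ell}$, where $q_1,\dots,q_\ell$ are distinct odd primes and all $\alpha_i\ge 1$. Then the digraph $G_p^k$ has exactly two (weakly connected) components if and only if $p-1=2^{\beta_0}q_1^{\beta_1}\cdots q_\ell^{\beta_\ell}$ for some integers $\beta_0,\dots,\beta_\ell\ge 0$.
   Context: $G_p^k$ is the digraph with vertex set $\mathbb{Z}_p$ and a directed edge $(a,b)$ if and only if $a^k\equiv b\pmod p$. -}

module Defs where

open import Data.Nat using (ℕ; zero; suc; _*_; _^_; _%_; NonZero)
open import Data.Fin using (Fin; toℕ; zero; suc)
open import Data.Product using (_×_; ∃-syntax)
open import Data.Sum using (_⊎_)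
open import Relation.Nullary using (¬_)
open import Relation.Binary.PropositionalEquality using (_≡_)
open import Relation.Binary.Construct.Closure.Equivalence using (EqClosure)

∏ : (n : ℕ) → (Fin n → ℕ) → ℕ
∏ zero    f = 1
∏ (suc n) f = f zero * ∏ n (λ i → f (suc i))

-- The digraph G_p^k: vertex set Z_p (represented by Fin p = {0,…,p-1}),
-- with a directed edge (a , b) iff a^k ≡ b (mod p).
Edge : (p k : ℕ) .{{_ : NonZero p}} → Fin p → Fin p → Set
Edge p k a b = (toℕ a ^ k) % p ≡ toℕ b

WeaklyConnected : (p k : ℕ) .{{_ : NonZero p}} → Fin p → Fin p → Set
WeaklyConnected p k = EqClosure (Edge p k)

HasExactlyTwoComponents : (p k : ℕ) .{{_ : NonZero p}} → Set
HasExactlyTwoComponents p k =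
  ∃[ a ] ∃[ b ] (¬ WeaklyConnected p k a b
    × ((x : Fin p) → WeaklyConnected p k x a ⊎ WeaklyConnected p k x b))

{-# OPTIONS --safe #-}
-- An edge a → b of G_p^k says b ≡ a^k (mod p), so walking n edges from a reaches a^(k^n).
-- If p − 1 divides some k^M, Fermat's little theorem sends every nonzero vertex to 1 in M
-- steps, while 0 is connected only to itself.  Otherwise p − 1 = D·m with m > 1 coprime
-- to k, D collecting the prime factors that p − 1 shares with k.  Then {a : a^D ≡ 1} is
-- a union of components (an edge can be reversed by Bézout for m and k), it contains 1
-- but not 0, and it misses some nonzero residue: were y^D ≡ 1 for all 0 < y < p, the
-- (p − 1)-st finite difference of y ↦ y^D ∸ 1 would be ±1 yet divisible by p, since the
-- degree-D polynomial part is annihilated.  This yields a third component.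
module Submission where

open import Defs

module FiniteDifferences where

  open import Data.Nat as ℕ using (ℕ; zero; suc; _^_; _≤_; _<_; z≤n; s≤s)
  import Data.Nat.Properties as ℕ
  open import Data.Nat.Divisibility as ℕ using (∣1⇒≡1)
  open import Data.Integer using (ℤ; +_; _+_; _*_; _-_; -_; ∣_∣; 0ℤ; 1ℤ; -1ℤ)
  open import Data.Integer.Properties
    using (m-n≡m⊖n; ⊖-≥; +-inverseʳ; +-identityˡ; +-identityʳ; *-zeroʳ; pos-+; pos-*; ∣-i∣≡∣i∣)
  open import Data.Integer.Divisibility.Signed using (_∣_; ∣m∣n⇒∣m-n; ∣⇒∣ᵤ; ∣ᵤ⇒∣)
  open import Data.Integer.Solver using (module +-*-Solver)
  open import Function.Base using (_∘_; const)
  open import Relation.Nullary using (¬_)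
  open import Relation.Binary.PropositionalEquality
  open +-*-Solver using (solve; _:+_; _:*_; _:-_; _:=_; con)

  Δ : (ℕ → ℤ) → ℕ → ℤ
  Δ f x = f (suc x) - f x

  Δ^ : ℕ → (ℕ → ℤ) → ℕ → ℤ
  Δ^ zero    f = f
  Δ^ (suc n) f = Δ^ n (Δ f)

  Δ^-cong : ∀ n {f g} → f ≗ g → Δ^ n f ≗ Δ^ n g
  Δ^-cong zero    f≗g = f≗g
  Δ^-cong (suc n) f≗g = Δ^-cong n (λ x → cong₂ _-_ (f≗g (suc x)) (f≗g x))

  Δ^-+ : ∀ n f g x → Δ^ n (λ y → f y + g y) x ≡ Δ^ n f x + Δ^ n g x
  Δ^-+ zero    f g x = refl
  Δ^-+ (suc n) f g x = trans (Δ^-cong n Δ-+ x) (Δ^-+ n (Δ f) (Δ g) x)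
    where
    Δ-+ : ∀ y → Δ (λ y → f y + g y) y ≡ Δ f y + Δ g y
    Δ-+ y = solve 4 (λ a b c d → (a :+ b) :- (c :+ d) := (a :- c) :+ (b :- d)) refl
                    (f (suc y)) (g (suc y)) (f y) (g y)

  Δ^-shift : ∀ n f x → Δ^ n (f ∘ suc) x ≡ Δ^ n f (suc x)
  Δ^-shift zero    f x = refl
  Δ^-shift (suc n) f x = Δ^-shift n (Δ f) x

  Δ^-+ℕ : ∀ m n f → Δ^ (m ℕ.+ n) f ≗ Δ^ n (Δ^ m f)
  Δ^-+ℕ zero    n f x = refl
  Δ^-+ℕ (suc m) n f x = Δ^-+ℕ m n (Δ f) x

  Δ^-const0 : ∀ n → Δ^ n (const 0ℤ) ≗ const 0ℤ
  Δ^-const0 zero    x = refl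
  Δ^-const0 (suc n) x = Δ^-const0 n x

  record DegreeAtMost (d : ℕ) (f : ℕ → ℤ) : Set where
    constructor degree≤
    field Δ^[1+d]≗0 : Δ^ (suc d) f ≗ const 0ℤ

  Δ^-degree : ∀ {d n f} → DegreeAtMost d f → d < n → Δ^ n f ≗ const 0ℤ
  Δ^-degree {d} {n} {f} (degree≤ Δ^f≗0) d<n x = begin
    Δ^ n f x ≡⟨ cong (λ k → Δ^ k f x) (ℕ.m+[n∸m]≡n d<n) ⟨
    Δ^ (suc d ℕ.+ c) f x ≡⟨ Δ^-+ℕ (suc d) c f x ⟩
    Δ^ c (Δ^ (suc d) f) x ≡⟨ Δ^-cong c Δ^f≗0 x ⟩
    Δ^ c (const 0ℤ) x ≡⟨ Δ^-const0 c x ⟩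
    0ℤ ∎
    where
    open ≡-Reasoning
    c : ℕ
    c = n ℕ.∸ suc d

  degree-mono : ∀ {d e f} → d ≤ e → DegreeAtMost d f → DegreeAtMost e f
  degree-mono d≤e deg = degree≤ (Δ^-degree deg (s≤s d≤e))

  degree-cong : ∀ {d f g} → f ≗ g → DegreeAtMost d f → DegreeAtMost d g
  degree-cong {d} f≗g (degree≤ Δ^f≗0) = degree≤ (λ x → trans (sym (Δ^-cong (suc d) f≗g x)) (Δ^f≗0 x))

  degree-const : ∀ c → DegreeAtMost 0 (const c)
  degree-const c = degree≤ (λ _ → +-inverseʳ c)

  degree-+ : ∀ {d f g} → DegreeAtMost d f → DegreeAtMost d g → DegreeAtMost d (λ x → f x + g x)
  degree-+ {d} {f} {g} (degree≤ Δ^f≗0) (degree≤ Δ^g≗0) =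
    degree≤ (λ x → trans (Δ^-+ (suc d) f g x) (cong₂ _+_ (Δ^f≗0 x) (Δ^g≗0 x)))

  degree-shift : ∀ {d f} → DegreeAtMost d f → DegreeAtMost d (f ∘ suc)
  degree-shift {d} {f} (degree≤ Δ^f≗0) = degree≤ (λ x → trans (Δ^-shift (suc d) f x) (Δ^f≗0 (suc x)))

  Δ-x* : ∀ h y → Δ (λ x → + x * h x) y ≡ + y * Δ h y + h (suc y)
  Δ-x* h y = trans (cong (λ z → z * h (suc y) - + y * h y) (pos-+ 1 y))
    (solve 3 (λ y a b → (con 1ℤ :+ y) :* a :- y :* b := y :* (a :- b) :+ a) refl (+ y) (h (suc y)) (h y))

  degree-Δ : ∀ {d f} → DegreeAtMost (suc d) f → DegreeAtMost d (Δ f)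
  degree-Δ (degree≤ Δ^f≗0) = degree≤ Δ^f≗0

  degree-Δ⁻ : ∀ {d f} → DegreeAtMost d (Δ f) → DegreeAtMost (suc d) f
  degree-Δ⁻ (degree≤ Δ^Δf≗0) = degree≤ Δ^Δf≗0

  degree-x* : ∀ {d h} → DegreeAtMost d h → DegreeAtMost (suc d) (λ x → + x * h x)
  degree-x*Δ : ∀ {d h} → DegreeAtMost d h → DegreeAtMost d (λ x → + x * Δ h x)

  degree-x* {d} {h} deg =
    degree-Δ⁻ (degree-cong (sym ∘ Δ-x* h) (degree-+ (degree-x*Δ deg) (degree-shift deg)))

  degree-x*Δ {zero}  (degree≤ Δh≗0) =
    degree-cong (λ x → trans (sym (*-zeroʳ (+ x))) (cong (+ x *_) (sym (Δh≗0 x)))) (degree-const 0ℤ)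
  degree-x*Δ {suc d} deg = degree-x* (degree-Δ deg)

  degree-pow : ∀ d → DegreeAtMost d (λ x → + (x ^ d))
  degree-pow zero    = degree-const 1ℤ
  degree-pow (suc d) = degree-cong (λ x → sym (pos-* x (x ^ d))) (degree-x* (degree-pow d))

  δ₀ : ℤ → ℕ → ℤ
  δ₀ c zero    = c
  δ₀ c (suc _) = 0ℤ

  ∣Δ^δ₀∣ : ∀ n c → ∣ Δ^ n (δ₀ c) 0 ∣ ≡ ∣ c ∣
  ∣Δ^δ₀∣ zero    c = refl
  ∣Δ^δ₀∣ (suc n) c = trans (cong ∣_∣ (Δ^-cong n Δδ₀ 0)) (trans (∣Δ^δ₀∣ n (- c)) (∣-i∣≡∣i∣ c))
    where
    Δδ₀ : Δ (δ₀ c) ≗ δ₀ (- c)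
    Δδ₀ zero    = +-identityˡ (- c)
    Δδ₀ (suc x) = refl

  Δ^-∣ : ∀ {d} n f x → (∀ i → i ≤ n → d ∣ f (x ℕ.+ i)) → d ∣ Δ^ n f x
  Δ^-∣ {d} zero    f x d∣f = subst (d ∣_) (cong f (ℕ.+-identityʳ x)) (d∣f 0 z≤n)
  Δ^-∣ {d} (suc n) f x d∣f = Δ^-∣ n (Δ f) x (λ i i≤n →
    subst (λ y → d ∣ f y - f (x ℕ.+ i)) (ℕ.+-suc x i)
      (∣m∣n⇒∣m-n (d∣f (suc i) (s≤s i≤n)) (d∣f i (ℕ.m≤n⇒m≤1+n i≤n))))

  +[a∸1]≡+a-1 : ∀ {a} → 0 < a → + (a ℕ.∸ 1) ≡ + a - 1ℤ
  +[a∸1]≡+a-1 {suc a} _ = sym (trans (m-n≡m⊖n (suc a) 1) (⊖-≥ (s≤s z≤n)))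

  -- Truncation makes f vanish at 0, so f = g + δ₀ 1: the degree-D part g is killed by Δ^ n,
  -- the point mass is not, and yet d divides every value of f.
  ¬∀[y≤n]d∣y^D∸1 : ∀ {d D n} → 1 < d → 0 < D → D < n → ¬ (∀ y → y ≤ n → d ℕ.∣ y ^ D ℕ.∸ 1)
  ¬∀[y≤n]d∣y^D∸1 {d} {D@(suc _)} {n} 1<d _ D<n d∣y^D∸1 = ℕ.<⇒≢ 1<d (sym (∣1⇒≡1 d∣1))
    where
    f g : ℕ → ℤ
    f y = + (y ^ D ℕ.∸ 1)
    g y = + (y ^ D) - 1ℤ
    f≗g+δ₀ : ∀ y → f y ≡ g y + δ₀ 1ℤ y
    f≗g+δ₀ zero    = refl
    f≗g+δ₀ (suc y) = trans (+[a∸1]≡+a-1 (ℕ.m^n>0 (suc y) D)) (sym (+-identityʳ (g (suc y))))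
    Δ^g≡0 : Δ^ n g 0 ≡ 0ℤ
    Δ^g≡0 = Δ^-degree (degree-+ (degree-pow D) (degree-mono z≤n (degree-const -1ℤ))) D<n 0
    Δ^f≡Δ^δ₀ : Δ^ n f 0 ≡ Δ^ n (δ₀ 1ℤ) 0
    Δ^f≡Δ^δ₀ = begin
      Δ^ n f 0 ≡⟨ Δ^-cong n f≗g+δ₀ 0 ⟩
      Δ^ n (λ y → g y + δ₀ 1ℤ y) 0 ≡⟨ Δ^-+ n g (δ₀ 1ℤ) 0 ⟩
      Δ^ n g 0 + Δ^ n (δ₀ 1ℤ) 0 ≡⟨ cong (_+ Δ^ n (δ₀ 1ℤ) 0) Δ^g≡0 ⟩
      0ℤ + Δ^ n (δ₀ 1ℤ) 0 ≡⟨ +-identityˡ _ ⟩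
      Δ^ n (δ₀ 1ℤ) 0 ∎
      where open ≡-Reasoning
    d∣1 : d ℕ.∣ 1
    d∣1 = subst (d ℕ.∣_) (trans (cong ∣_∣ Δ^f≡Δ^δ₀) (∣Δ^δ₀∣ n 1ℤ))
                (∣⇒∣ᵤ (Δ^-∣ n f 0 (λ i i≤n → ∣ᵤ⇒∣ {+ d} (d∣y^D∸1 i i≤n))))

open FiniteDifferences using (¬∀[y≤n]d∣y^D∸1)

open import Data.Nat as ℕ
  using (ℕ; zero; suc; _+_; _*_; _^_; _∸_; _≤_; _<_; _⊔_; _%_; _/_; NonZero; z≤n; s≤s;
         >-nonZero; >-nonZero⁻¹; nonTrivial⇒n>1)
open import Data.Nat.Properties
open import Algebra.Properties.CommutativeSemiring.Binomial +-*-commutativeSemiring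
  using (theorem; binomialTerm)
open import Algebra.Properties.Monoid.Sum +-0-monoid using (sum; sum-init-last; sum-cong-≗)
import Algebra.Definitions.RawSemiring
open import Data.Nat.DivMod
open import Data.Nat.Divisibility
open import Data.Nat.Induction using (<-rec)
open import Data.Nat.Primality
  using (Prime; euclidsLemma; prime⇒irreducible; prime⇒nonZero; prime⇒nonTrivial; prime[2]; ¬prime[1])
open import Data.Nat.Combinatorics using (_C_; nCn≡1; nC1≡n; nCk+nC[k+1]≡[n+1]C[k+1])
open import Data.Nat.Combinatorics.Specification using (k>n⇒nCk≡0)
open import Data.Nat.GCD using (module Bézout)
open import Data.Nat.Coprimality as Coprime using (Coprime; coprime-Bézout; coprime-divisor; 1-coprimeTo)
open import Data.Fin using (Fin; zero; suc; toℕ; fromℕ; fromℕ<)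
open import Data.Fin.Properties using (toℕ<n; toℕ-inject₁; toℕ-fromℕ; toℕ-fromℕ<; toℕ-injective; ¬∀⟶∃¬)
open import Data.Vec.Functional using (Vector; tail; init; last; _∷_)
open import Data.Product using (_×_; _,_; Σ-syntax; ∃-syntax)
open import Data.Sum using (_⊎_; inj₁; inj₂; fromInj₂)
open import Function.Base using (_∘_)
open import Function.Bundles using (_⇔_; mk⇔; Equivalence)
open import Function.Properties.Equivalence using (⇔-isEquivalence)
open import Relation.Binary.Bundles using (Setoid)
open import Relation.Binary.Structures using (IsEquivalence)
open import Relation.Binary.Construct.Closure.Equivalence as EqClosure using (gfold; return)
open import Relation.Nullary using (¬_; Dec; yes; no; contradiction)
open import Relation.Nullary.Decidable using (map′; _⊎-dec_)
open import Relation.Binary.PropositionalEquality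
import Relation.Binary.Reasoning.Setoid as SetoidReasoning

[k+1]*[n+1]C[k+1]≡[n+1]*nCk : ∀ n k → suc k * (suc n C suc k) ≡ suc n * (n C k)
[k+1]*[n+1]C[k+1]≡[n+1]*nCk n       zero    = trans (*-identityˡ _) (trans (nC1≡n (suc n)) (sym (*-identityʳ _)))
[k+1]*[n+1]C[k+1]≡[n+1]*nCk zero    (suc k) =
  trans (cong (suc (suc k) *_) (k>n⇒nCk≡0 {1} {suc (suc k)} (s≤s (s≤s z≤n)))) (*-zeroʳ (suc (suc k)))
[k+1]*[n+1]C[k+1]≡[n+1]*nCk (suc n) (suc k) = begin
  suc (suc k) * (suc (suc n) C suc (suc k))
    ≡⟨ cong (suc (suc k) *_) (nCk+nC[k+1]≡[n+1]C[k+1] (suc n) (suc k)) ⟨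
  suc (suc k) * (A + suc n C suc (suc k))
    ≡⟨ *-distribˡ-+ (suc (suc k)) A _ ⟩
  (A + suc k * A) + suc (suc k) * (suc n C suc (suc k))
    ≡⟨ cong₂ (λ u v → (A + u) + v) ([k+1]*[n+1]C[k+1]≡[n+1]*nCk n k)
                                   ([k+1]*[n+1]C[k+1]≡[n+1]*nCk n (suc k)) ⟩
  (A + suc n * (n C k)) + suc n * (n C suc k)
    ≡⟨ +-assoc A _ _ ⟩
  A + (suc n * (n C k) + suc n * (n C suc k))
    ≡⟨ cong (A +_) (*-distribˡ-+ (suc n) (n C k) _) ⟨
  A + suc n * (n C k + n C suc k)
    ≡⟨ cong (λ u → A + suc n * u) (nCk+nC[k+1]≡[n+1]C[k+1] n k) ⟩
  suc (suc n) * A ∎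
  where
  open ≡-Reasoning
  A : ℕ
  A = suc n C suc k

prime∣pCk : ∀ {p k} → Prime p → 0 < k → k < p → p ∣ p C k
prime∣pCk {suc n} {suc k} p-prime _ k<p =
  fromInj₂ (λ p∣k → contradiction (∣⇒≤ p∣k) (<⇒≱ k<p))
           (euclidsLemma (suc k) (suc n C suc k) p-prime p∣[k]*pCk)
  where
  p∣[k]*pCk : suc n ∣ suc k * (suc n C suc k)
  p∣[k]*pCk = divides (n C k) (trans ([k+1]*[n+1]C[k+1]≡[n+1]*nCk n k) (*-comm (suc n) (n C k)))

0^n≡0 : ∀ n .{{_ : NonZero n}} → 0 ^ n ≡ 0
0^n≡0 (suc n) = refl

∣-sum : ∀ {d n} (t : Vector ℕ n) → (∀ i → d ∣ t i) → d ∣ sum t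
∣-sum {n = zero}  t d∣t = _ ∣0
∣-sum {n = suc n} t d∣t = ∣m∣n⇒∣m+n (d∣t zero) (∣-sum (tail t) (d∣t ∘ suc))

-- The library's binomial theorem is phrased with the semiring's own _^_ and _×_,
-- which agree with those of ℕ only propositionally.
module Semiringℕ = Algebra.Definitions.RawSemiring ℕ.+-*-rawSemiring

^ᴬ≡^ : ∀ x n → x Semiringℕ.^ n ≡ x ^ n
^ᴬ≡^ x zero    = refl
^ᴬ≡^ x (suc n) = cong (x *_) (^ᴬ≡^ x n)

×ᴬ≡* : ∀ n x → n Semiringℕ.× x ≡ n * x
×ᴬ≡* zero    x = refl
×ᴬ≡* (suc n) x = cong (x +_) (×ᴬ≡* n x)

binomialTerm[x,1]≡ : ∀ x n (k : Fin (suc n)) → binomialTerm x 1 n k ≡ (n C toℕ k) * x ^ toℕ k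
binomialTerm[x,1]≡ x n k = begin
  (n C toℕ k) Semiringℕ.× (x Semiringℕ.^ toℕ k * 1 Semiringℕ.^ (n ∸ toℕ k))
    ≡⟨ ×ᴬ≡* (n C toℕ k) _ ⟩
  (n C toℕ k) * (x Semiringℕ.^ toℕ k * 1 Semiringℕ.^ (n ∸ toℕ k))
    ≡⟨ cong₂ (λ u v → (n C toℕ k) * (u * v)) (^ᴬ≡^ x (toℕ k))
                                             (trans (^ᴬ≡^ 1 (n ∸ toℕ k)) (^-zeroˡ (n ∸ toℕ k))) ⟩
  (n C toℕ k) * (x ^ toℕ k * 1)
    ≡⟨ cong ((n C toℕ k) *_) (*-identityʳ (x ^ toℕ k)) ⟩
  (n C toℕ k) * x ^ toℕ k ∎
  where open ≡-Reasoning

[x+1]^[1+n]≡1+∑+x^[1+n] : ∀ n x →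
  (x + 1) ^ suc n ≡ (1 + sum (λ (i : Fin n) → (suc n C suc (toℕ i)) * x ^ suc (toℕ i))) + x ^ suc n
[x+1]^[1+n]≡1+∑+x^[1+n] n x = begin
  (x + 1) ^ suc n                       ≡⟨ ^ᴬ≡^ (x + 1) (suc n) ⟨
  (x + 1) Semiringℕ.^ suc n             ≡⟨ theorem (suc n) x 1 ⟩
  sum (binomialTerm x 1 (suc n))        ≡⟨ sum-cong-≗ (binomialTerm[x,1]≡ x (suc n)) ⟩
  sum t                                 ≡⟨ sum-init-last t ⟩
  (t zero + sum (tail (init t))) + last t ≡⟨ cong₂ (λ s l → (1 + s) + l) middle last-term ⟩
  (1 + sum (λ (i : Fin n) → (suc n C suc (toℕ i)) * x ^ suc (toℕ i))) + x ^ suc n ∎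
  where
  open ≡-Reasoning
  t : Vector ℕ (suc (suc n))
  t k = (suc n C toℕ k) * x ^ toℕ k
  middle : sum (tail (init t)) ≡ sum (λ (i : Fin n) → (suc n C suc (toℕ i)) * x ^ suc (toℕ i))
  middle = sum-cong-≗ {n} (λ i → cong (λ j → (suc n C suc j) * x ^ suc j) (toℕ-inject₁ i))
  last-term : last t ≡ x ^ suc n
  last-term = begin
    (suc n C toℕ (fromℕ (suc n))) * x ^ toℕ (fromℕ (suc n))
      ≡⟨ cong (λ j → (suc n C j) * x ^ j) (toℕ-fromℕ (suc n)) ⟩
    (suc n C suc n) * x ^ suc n
      ≡⟨ cong (_* x ^ suc n) (nCn≡1 (suc n)) ⟩
    1 * x ^ suc n
      ≡⟨ *-identityˡ (x ^ suc n) ⟩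
    x ^ suc n ∎

freshman's-dream : ∀ {p} .{{_ : NonZero p}} → Prime p → ∀ x → (x + 1) ^ p % p ≡ (x ^ p + 1) % p
freshman's-dream {suc n} p-prime x = begin
  (x + 1) ^ suc n % suc n ≡⟨ cong (_% suc n) ([x+1]^[1+n]≡1+∑+x^[1+n] n x) ⟩
  ((1 + middle) + x ^ suc n) % suc n ≡⟨ cong (_% suc n) (+-comm (1 + middle) _) ⟩
  (x ^ suc n + (1 + middle)) % suc n ≡⟨ cong (_% suc n) (+-assoc (x ^ suc n) 1 middle) ⟨
  (x ^ suc n + 1 + middle) % suc n ≡⟨ %-remove-+ʳ (x ^ suc n + 1) p∣middle ⟩
  (x ^ suc n + 1) % suc n ∎
  where
  open ≡-Reasoning
  term : Fin n → ℕ
  term i = (suc n C suc (toℕ i)) * x ^ suc (toℕ i)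
  middle : ℕ
  middle = sum term
  p∣middle : suc n ∣ middle
  p∣middle = ∣-sum term (λ i → ∣m⇒∣m*n _ (prime∣pCk p-prime (s≤s z≤n) (s≤s (toℕ<n i))))

module Congruence (m : ℕ) .{{_ : NonZero m}} where

  infix 4 _≋_
  record _≋_ (a b : ℕ) : Set where
    constructor mk≋
    field un≋ : a % m ≡ b % m
  open _≋_ public

  ≋-isEquivalence : IsEquivalence _≋_
  ≋-isEquivalence = record
    { refl = mk≋ refl
    ; sym = λ (mk≋ e) → mk≋ (sym e)
    ; trans = λ (mk≋ e) (mk≋ f) → mk≋ (trans e f)
    }

  ≋-setoid : Setoid _ _
  ≋-setoid = record { isEquivalence = ≋-isEquivalence }

  open IsEquivalence ≋-isEquivalence public
    using () renaming (refl to ≋-refl; sym to ≋-sym; trans to ≋-trans; reflexive to ≡⇒≋)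

  infix 4 _≋?_
  _≋?_ : ∀ a b → Dec (a ≋ b)
  a ≋? b = map′ mk≋ un≋ (a % m ≟ b % m)

  <-≋⇒≡ : ∀ {a b} → a < m → b < m → a ≋ b → a ≡ b
  <-≋⇒≡ a<m b<m (mk≋ e) = trans (sym (m<n⇒m%n≡m a<m)) (trans e (m<n⇒m%n≡m b<m))

  1≉0 : 1 < m → ¬ 1 ≋ 0
  1≉0 1<m 1≋0 = 0≢1+n (sym (<-≋⇒≡ 1<m (>-nonZero⁻¹ m) 1≋0))

  +-cong-≋ : ∀ {a a′ b b′} → a ≋ a′ → b ≋ b′ → a + b ≋ a′ + b′
  +-cong-≋ {a} {a′} {b} {b′} (mk≋ e) (mk≋ f) = mk≋ (begin
    (a + b) % m ≡⟨ %-distribˡ-+ a b m ⟩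
    (a % m + b % m) % m ≡⟨ cong₂ (λ u v → (u + v) % m) e f ⟩
    (a′ % m + b′ % m) % m ≡⟨ %-distribˡ-+ a′ b′ m ⟨
    (a′ + b′) % m ∎)
    where open ≡-Reasoning

  *-cong-≋ : ∀ {a a′ b b′} → a ≋ a′ → b ≋ b′ → a * b ≋ a′ * b′
  *-cong-≋ {a} {a′} {b} {b′} (mk≋ e) (mk≋ f) = mk≋ (begin
    (a * b) % m ≡⟨ %-distribˡ-* a b m ⟩
    (a % m * (b % m)) % m ≡⟨ cong₂ (λ u v → (u * v) % m) e f ⟩
    (a′ % m * (b′ % m)) % m ≡⟨ %-distribˡ-* a′ b′ m ⟨
    (a′ * b′) % m ∎)
    where open ≡-Reasoning

  ^-cong-≋ : ∀ {a a′} n → a ≋ a′ → a ^ n ≋ a′ ^ n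
  ^-cong-≋ zero    a≋a′ = ≋-refl
  ^-cong-≋ (suc n) a≋a′ = *-cong-≋ a≋a′ (^-cong-≋ n a≋a′)

  %-≋ : ∀ a → a % m ≋ a
  %-≋ a = mk≋ (m%n%n≡m%n a m)

  ∣⇒≋0 : ∀ {a} → m ∣ a → a ≋ 0
  ∣⇒≋0 {a} m∣a = mk≋ (trans (n∣m⇒m%n≡0 a m m∣a) (sym (n∣m⇒m%n≡0 0 m (m ∣0))))

  ≋⇒∣∸ : ∀ {a b} → a ≋ b → m ∣ b ∸ a
  ≋⇒∣∸ {a} {b} (mk≋ e) = divides (b / m ∸ a / m) (begin
    b ∸ a ≡⟨ cong₂ _∸_ (m≡m%n+[m/n]*n b m) (m≡m%n+[m/n]*n a m) ⟩
    (b % m + b / m * m) ∸ (a % m + a / m * m) ≡⟨ cong (λ r → (b % m + b / m * m) ∸ (r + a / m * m)) e ⟩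
    (b % m + b / m * m) ∸ (b % m + a / m * m) ≡⟨ [m+n]∸[m+o]≡n∸o (b % m) _ _ ⟩
    b / m * m ∸ a / m * m ≡⟨ *-distribʳ-∸ m (b / m) (a / m) ⟨
    (b / m ∸ a / m) * m ∎)
    where open ≡-Reasoning

  ∣∸⇒≋ : ∀ {a b} → a ≤ b → m ∣ b ∸ a → a ≋ b
  ∣∸⇒≋ {a} {b} a≤b m∣b∸a = mk≋ (begin
    a % m ≡⟨ %-remove-+ʳ a m∣b∸a ⟨
    (a + (b ∸ a)) % m ≡⟨ cong (_% m) (m+[n∸m]≡n a≤b) ⟩
    b % m ∎)
    where open ≡-Reasoning

  *-≋⇒∣*∸ : ∀ x {a b} → x * a ≋ x * b → m ∣ x * (b ∸ a)
  *-≋⇒∣*∸ x {a} {b} e = subst (m ∣_) (sym (*-distribˡ-∸ x b a)) (≋⇒∣∸ e)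

  ^*≋1 : ∀ {z e} c → z ^ e ≋ 1 → z ^ (c * e) ≋ 1
  ^*≋1 {z} {e} c z^e≋1 = begin
    z ^ (c * e) ≡⟨ cong (z ^_) (*-comm c e) ⟩
    z ^ (e * c) ≡⟨ ^-*-assoc z e c ⟨
    (z ^ e) ^ c ≈⟨ ^-cong-≋ c z^e≋1 ⟩
    1 ^ c ≡⟨ ^-zeroˡ c ⟩
    1 ∎
    where open SetoidReasoning ≋-setoid

  ^≋1∧^suc≋1⇒≋1 : ∀ {z c} → z ^ c ≋ 1 → z ^ suc c ≋ 1 → z ≋ 1
  ^≋1∧^suc≋1⇒≋1 {z} {c} z^c≋1 z^suc-c≋1 = begin
    z ≡⟨ *-identityʳ z ⟨
    z * 1 ≈⟨ *-cong-≋ (≋-refl {z}) (≋-sym z^c≋1) ⟩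
    z ^ suc c ≈⟨ z^suc-c≋1 ⟩
    1 ∎
    where open SetoidReasoning ≋-setoid

  ^≋1-coprime : ∀ {z a b} → Coprime a b → z ^ a ≋ 1 → z ^ b ≋ 1 → z ≋ 1
  ^≋1-coprime {z} {a} {b} a⊥b z^a≋1 z^b≋1 with coprime-Bézout a⊥b
  ... | Bézout.+- x y 1+yb≡xa = ^≋1∧^suc≋1⇒≋1 {z} {y * b}
    (^*≋1 {z} {b} y z^b≋1) (subst (λ e → z ^ e ≋ 1) (sym 1+yb≡xa) (^*≋1 {z} {a} x z^a≋1))
  ... | Bézout.-+ x y 1+xa≡yb = ^≋1∧^suc≋1⇒≋1 {z} {x * a}
    (^*≋1 {z} {a} x z^a≋1) (subst (λ e → z ^ e ≋ 1) (sym 1+xa≡yb) (^*≋1 {z} {b} y z^b≋1))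

  module _ (m-prime : Prime m) where

    ∣*∧∤⇒∣ : ∀ {x y} → ¬ m ∣ x → m ∣ x * y → m ∣ y
    ∣*∧∤⇒∣ {x} {y} m∤x m∣xy = fromInj₂ (λ m∣x → contradiction m∣x m∤x) (euclidsLemma x y m-prime m∣xy)

    *-cancelˡ-≋ : ∀ {x a b} → ¬ m ∣ x → x * a ≋ x * b → a ≋ b
    *-cancelˡ-≋ {x} {a} {b} m∤x xa≋xb with ≤-total a b
    ... | inj₁ a≤b = ∣∸⇒≋ a≤b (∣*∧∤⇒∣ m∤x (*-≋⇒∣*∸ x xa≋xb))
    ... | inj₂ b≤a = ≋-sym (∣∸⇒≋ b≤a (∣*∧∤⇒∣ m∤x (*-≋⇒∣*∸ x (≋-sym xa≋xb))))

    fermat : ∀ x → x ^ m ≋ x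
    fermat zero = ≡⇒≋ (0^n≡0 m)
    fermat (suc x) = begin
      suc x ^ m ≡⟨ cong (_^ m) (+-comm 1 x) ⟩
      (x + 1) ^ m ≈⟨ mk≋ (freshman's-dream m-prime x) ⟩
      x ^ m + 1 ≈⟨ +-cong-≋ (fermat x) ≋-refl ⟩
      x + 1 ≡⟨ +-comm x 1 ⟩
      suc x ∎
      where open SetoidReasoning ≋-setoid

    fermat-little : ∀ {x} → ¬ m ∣ x → x ^ (m ∸ 1) ≋ 1
    fermat-little {x} m∤x = *-cancelˡ-≋ m∤x (begin
      x * x ^ (m ∸ 1) ≡⟨ cong (x ^_) (suc-pred m) ⟩
      x ^ m ≈⟨ fermat x ⟩
      x ≡⟨ *-identityʳ x ⟨
      x * 1 ∎)
      where open SetoidReasoning ≋-setoid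

^-distribʳ-* : ∀ a b n → (a * b) ^ n ≡ a ^ n * b ^ n
^-distribʳ-* a b zero    = refl
^-distribʳ-* a b (suc n) = begin
  a * b * (a * b) ^ n     ≡⟨ cong (a * b *_) (^-distribʳ-* a b n) ⟩
  a * b * (a ^ n * b ^ n) ≡⟨ *-assoc a b _ ⟩
  a * (b * (a ^ n * b ^ n)) ≡⟨ cong (a *_) (x∙yz≈y∙xz b (a ^ n) (b ^ n)) ⟩
  a * (a ^ n * (b * b ^ n)) ≡⟨ *-assoc a (a ^ n) _ ⟨
  a * a ^ n * (b * b ^ n) ∎
  where
  open ≡-Reasoning
  open import Algebra.Properties.CommutativeSemigroup *-commutativeSemigroup using (x∙yz≈y∙xz)

^-monoʳ-∣ : ∀ a {m n} → m ≤ n → a ^ m ∣ a ^ n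
^-monoʳ-∣ a {m} {n} m≤n = divides (a ^ (n ∸ m)) (begin
  a ^ n ≡⟨ cong (a ^_) (m+[n∸m]≡n m≤n) ⟨
  a ^ (m + (n ∸ m)) ≡⟨ ^-distribˡ-+-* a m (n ∸ m) ⟩
  a ^ m * a ^ (n ∸ m) ≡⟨ *-comm (a ^ m) _ ⟩
  a ^ (n ∸ m) * a ^ m ∎)
  where open ≡-Reasoning

∏-^-∣ : ∀ {n} (r a b : Fin n → ℕ) → (∀ i → 1 ≤ a i) → ∃[ M ] ∏ n (λ i → r i ^ b i) ∣ ∏ n (λ i → r i ^ a i) ^ M
∏-^-∣ {zero}  r a b _   = 0 , ∣-refl
∏-^-∣ {suc n} r a b 1≤a with ∏-^-∣ (r ∘ suc) (a ∘ suc) (b ∘ suc) (1≤a ∘ suc)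
... | M , tail∣ = M′ , subst (∏ (suc n) (λ i → r i ^ b i) ∣_) (sym (^-distribʳ-* (r zero ^ a zero) _ M′))
                         (*-pres-∣ head∣ (∣-trans tail∣ (^-monoʳ-∣ _ (m≤n⊔m (b zero) M))))
  where
  M′ : ℕ
  M′ = b zero ⊔ M
  head∣ : r zero ^ b zero ∣ (r zero ^ a zero) ^ M′
  head∣ = subst (r zero ^ b zero ∣_) (sym (^-*-assoc (r zero) (a zero) M′))
            (^-monoʳ-∣ (r zero) (≤-trans (m≤m⊔n (b zero) M) (m≤n*m M′ (a zero) {{>-nonZero (1≤a zero)}})))

factor-out : ∀ {q} → 1 < q → ∀ n → 0 < n → Σ[ e ∈ ℕ ] Σ[ r ∈ ℕ ] (n ≡ q ^ e * r × ¬ q ∣ r × 0 < r)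
factor-out {q} 1<q = <-rec _ go
  where
  go : ∀ n → (∀ {c} → c < n → 0 < c → Σ[ e ∈ ℕ ] Σ[ r ∈ ℕ ] (c ≡ q ^ e * r × ¬ q ∣ r × 0 < r)) →
       0 < n → Σ[ e ∈ ℕ ] Σ[ r ∈ ℕ ] (n ≡ q ^ e * r × ¬ q ∣ r × 0 < r)
  go n rec 0<n with q ∣? n
  ... | no  q∤n = 0 , n , sym (+-identityʳ n) , q∤n , 0<n
  ... | yes (divides zero n≡0) = contradiction n≡0 (>⇒≢ 0<n)
  ... | yes (divides c@(suc _) n≡c*q) with rec (subst (c <_) (sym n≡c*q) (m<m*n c q 1<q)) (s≤s z≤n)
  ... | e , r , c≡qᵉ*r , q∤r , 0<r = suc e , r , n≡qᵉ⁺¹*r , q∤r , 0<r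
    where
    n≡qᵉ⁺¹*r : n ≡ q ^ suc e * r
    n≡qᵉ⁺¹*r = begin
      n ≡⟨ n≡c*q ⟩
      c * q ≡⟨ cong (_* q) c≡qᵉ*r ⟩
      q ^ e * r * q ≡⟨ *-comm (q ^ e * r) q ⟩
      q * (q ^ e * r) ≡⟨ *-assoc q (q ^ e) r ⟨
      q ^ suc e * r ∎
      where open ≡-Reasoning

factor-out-∏ : ∀ {ℓ} (r : Fin ℓ → ℕ) → (∀ i → 1 < r i) → ∀ n → 0 < n →
  Σ[ β ∈ (Fin ℓ → ℕ) ] Σ[ m ∈ ℕ ] (n ≡ ∏ ℓ (λ i → r i ^ β i) * m × (∀ i → ¬ r i ∣ m) × 0 < m)
factor-out-∏ {zero}  r _ n 0<n = (λ ()) , n , sym (+-identityʳ n) , (λ ()) , 0<n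
factor-out-∏ {suc ℓ} r 1<r n 0<n with factor-out (1<r zero) n 0<n
... | e , n′ , n≡r₀ᵉ*n′ , r₀∤n′ , 0<n′ with factor-out-∏ (r ∘ suc) (1<r ∘ suc) n′ 0<n′
... | β , m , n′≡∏*m , r∤m , 0<m = e ∷ β , m , n≡∏*m , r∤m′ , 0<m
  where
  n≡∏*m : n ≡ r zero ^ e * ∏ ℓ (λ i → r (suc i) ^ β i) * m
  n≡∏*m = trans n≡r₀ᵉ*n′ (trans (cong (r zero ^ e *_) n′≡∏*m) (sym (*-assoc (r zero ^ e) _ m)))
  r∤m′ : ∀ i → ¬ r i ∣ m
  r∤m′ zero    r₀∣m = r₀∤n′ (∣-trans r₀∣m (divides (∏ ℓ (λ i → r (suc i) ^ β i)) n′≡∏*m))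
  r∤m′ (suc i) = r∤m i

coprime-* : ∀ {m a b} → Coprime m a → Coprime m b → Coprime m (a * b)
coprime-* {m} {a} m⊥a m⊥b {d} (d∣m , d∣ab) = m⊥b (d∣m , coprime-divisor d⊥a d∣ab)
  where
  d⊥a : Coprime d a
  d⊥a (e∣d , e∣a) = m⊥a (∣-trans e∣d d∣m , e∣a)

coprime-^ : ∀ {m a} n → Coprime m a → Coprime m (a ^ n)
coprime-^ {m} zero    _   = Coprime.sym (1-coprimeTo m)
coprime-^ (suc n) m⊥a = coprime-* m⊥a (coprime-^ n m⊥a)

coprime-∏ : ∀ {m} ℓ (f : Fin ℓ → ℕ) → (∀ i → Coprime m (f i)) → Coprime m (∏ ℓ f)
coprime-∏ {m} zero    f _   = Coprime.sym (1-coprimeTo m)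
coprime-∏ (suc ℓ) f m⊥f = coprime-* (m⊥f zero) (coprime-∏ ℓ (f ∘ suc) (m⊥f ∘ suc))

∤-prime⇒coprime : ∀ {m q} → Prime q → ¬ q ∣ m → Coprime m q
∤-prime⇒coprime q-prime q∤m (d∣m , d∣q) with prime⇒irreducible q-prime d∣q
... | inj₁ d≡1 = d≡1
... | inj₂ refl = contradiction d∣m q∤m

^-comm : ∀ a b c → (a ^ b) ^ c ≡ (a ^ c) ^ b
^-comm a b c = trans (^-*-assoc a b c) (trans (cong (a ^_) (*-comm b c)) (sym (^-*-assoc a c b)))

prime∣m^n⇒prime∣m : ∀ {p m} n → Prime p → p ∣ m ^ n → p ∣ m
prime∣m^n⇒prime∣m zero    p-prime p∣1 = contradiction (subst Prime (∣1⇒≡1 p∣1) p-prime) ¬prime[1]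
prime∣m^n⇒prime∣m {m = m} (suc n) p-prime p∣m*m^n with euclidsLemma m (m ^ n) p-prime p∣m*m^n
... | inj₁ p∣m   = p∣m
... | inj₂ p∣m^n = prime∣m^n⇒prime∣m n p-prime p∣m^n

module Graph {p : ℕ} .{{_ : NonZero p}} (p-prime : Prime p) (k : ℕ) .{{_ : NonZero k}} where

  open Congruence p

  1<p : 1 < p
  1<p = nonTrivial⇒n>1 p {{prime⇒nonTrivial p-prime}}

  infix 4 _~_
  _~_ : Fin p → Fin p → Set
  _~_ = WeaklyConnected p k

  module ~ = IsEquivalence (EqClosure.isEquivalence (Edge p k))

  vertex : ℕ → Fin p
  vertex a = fromℕ< (m%n<n a p)

  vertex-≋ : ∀ a → toℕ (vertex a) ≋ a
  vertex-≋ a = ≋-trans (≡⇒≋ (toℕ-fromℕ< (m%n<n a p))) (%-≋ a)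

  ≋⇒≡ : ∀ {x y : Fin p} → toℕ x ≋ toℕ y → x ≡ y
  ≋⇒≡ {x} {y} e = toℕ-injective (<-≋⇒≡ (toℕ<n x) (toℕ<n y) e)

  edge⇒≋ : ∀ {a b} → Edge p k a b → toℕ b ≋ toℕ a ^ k
  edge⇒≋ {a} e = ≋-trans (≡⇒≋ (sym e)) (%-≋ (toℕ a ^ k))

  ~-invariant : (P : ℕ → Set) → (∀ {a b} → a ≋ b → P a → P b) → (∀ a → P a ⇔ P (a ^ k)) →
                ∀ {x y} → x ~ y → P (toℕ x) ⇔ P (toℕ y)
  ~-invariant P P-resp-≋ P⇔P^k = gfold ⇔-isEquivalence (P ∘ toℕ) edge-invariant
    where
    open IsEquivalence ⇔-isEquivalence using () renaming (trans to ⇔-trans)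
    edge-invariant : ∀ {a b} → Edge p k a b → P (toℕ a) ⇔ P (toℕ b)
    edge-invariant {a} e = ⇔-trans (P⇔P^k (toℕ a)) (mk⇔ (P-resp-≋ (≋-sym (edge⇒≋ e))) (P-resp-≋ (edge⇒≋ e)))

  ~-iterate : ∀ n x → ∃[ y ] (x ~ y × toℕ y ≋ toℕ x ^ (k ^ n))
  ~-iterate zero    x = x , ~.refl , ≡⇒≋ (sym (*-identityʳ (toℕ x)))
  ~-iterate (suc n) x with ~-iterate n x
  ... | y , x~y , y≋x^kⁿ = z , ~.trans x~y (return y→z) , (begin
    toℕ z                 ≈⟨ vertex-≋ (toℕ y ^ k) ⟩
    toℕ y ^ k             ≈⟨ ^-cong-≋ k y≋x^kⁿ ⟩
    (toℕ x ^ (k ^ n)) ^ k ≡⟨ ^-*-assoc (toℕ x) (k ^ n) k ⟩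
    toℕ x ^ (k ^ n * k)   ≡⟨ cong (toℕ x ^_) (*-comm (k ^ n) k) ⟩
    toℕ x ^ (k * k ^ n)   ∎)
    where
    open SetoidReasoning ≋-setoid
    z : Fin p
    z = vertex (toℕ y ^ k)
    y→z : Edge p k y z
    y→z = sym (toℕ-fromℕ< (m%n<n (toℕ y ^ k) p))

  ≋0-invariant : ∀ a → a ≋ 0 ⇔ a ^ k ≋ 0
  ≋0-invariant a = mk⇔ (λ a≋0 → ≋-trans (^-cong-≋ k a≋0) (≡⇒≋ (0^n≡0 k)))
                       (λ a^k≋0 → ∣⇒≋0 (prime∣m^n⇒prime∣m k p-prime (≋⇒∣∸ (≋-sym a^k≋0))))

  ~-preserves-≋0 : ∀ {x y} → x ~ y → toℕ x ≋ 0 → toℕ y ≋ 0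
  ~-preserves-≋0 = Equivalence.to ∘ ~-invariant (_≋ 0) (λ a≋b a≋0 → ≋-trans (≋-sym a≋b) a≋0) ≋0-invariant

  0≁1 : ¬ vertex 0 ~ vertex 1
  0≁1 0~1 = 1≉0 1<p (≋-trans (≋-sym (vertex-≋ 1)) (~-preserves-≋0 0~1 (vertex-≋ 0)))

  two-components : ∀ M → p ∸ 1 ∣ k ^ M → HasExactlyTwoComponents p k
  two-components M (divides c kᴹ≡c*[p-1]) = vertex 0 , vertex 1 , 0≁1 , cover
    where
    cover : ∀ x → x ~ vertex 0 ⊎ x ~ vertex 1
    cover x with toℕ x ≋? 0
    ... | yes x≋0 = inj₁ (~.reflexive (≋⇒≡ (≋-trans x≋0 (≋-sym (vertex-≋ 0)))))
    ... | no  x≉0 with ~-iterate M x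
    ... | y , x~y , y≋x^kᴹ = inj₂ (~.trans x~y (~.reflexive (≋⇒≡ (begin
      toℕ y                 ≈⟨ y≋x^kᴹ ⟩
      toℕ x ^ (k ^ M)       ≡⟨ cong (toℕ x ^_) kᴹ≡c*[p-1] ⟩
      toℕ x ^ (c * (p ∸ 1)) ≈⟨ ^*≋1 c (fermat-little p-prime (x≉0 ∘ ∣⇒≋0)) ⟩
      1                     ≈⟨ vertex-≋ 1 ⟨
      toℕ (vertex 1)        ∎))))
      where open SetoidReasoning ≋-setoid

  ¬two-components-of-three : ∀ {u v w} → ¬ u ~ v → ¬ u ~ w → ¬ v ~ w → ¬ HasExactlyTwoComponents p k
  ¬two-components-of-three {u} {v} {w} u≁v u≁w v≁w (a , b , _ , cover) with cover u | cover v | cover w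
  ... | inj₁ u~a | inj₁ v~a | _        = u≁v (~.trans u~a (~.sym v~a))
  ... | inj₂ u~b | inj₂ v~b | _        = u≁v (~.trans u~b (~.sym v~b))
  ... | inj₁ u~a | _        | inj₁ w~a = u≁w (~.trans u~a (~.sym w~a))
  ... | inj₂ u~b | _        | inj₂ w~b = u≁w (~.trans u~b (~.sym w~b))
  ... | _        | inj₁ v~a | inj₁ w~a = v≁w (~.trans v~a (~.sym w~a))
  ... | _        | inj₂ v~b | inj₂ w~b = v≁w (~.trans v~b (~.sym w~b))

  module _ {D m : ℕ} (D*m≡p-1 : D * m ≡ p ∸ 1) (1<m : 1 < m) (m⊥k : Coprime m k) where

    0<D : 0 < D
    0<D = n≢0⇒n>0 (λ D≡0 → <⇒≢ (m<n⇒0<n∸m 1<p) (trans (sym (cong (_* m) D≡0)) D*m≡p-1))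

    instance
      D≢0 : NonZero D
      D≢0 = >-nonZero 0<D

    D<p-1 : D < p ∸ 1
    D<p-1 = subst (D <_) D*m≡p-1 (m<m*n D m 1<m)

    ^D≋1-invariant : ∀ a → a ^ D ≋ 1 ⇔ (a ^ k) ^ D ≋ 1
    ^D≋1-invariant a = mk⇔ to from
      where
      open SetoidReasoning ≋-setoid
      to : a ^ D ≋ 1 → (a ^ k) ^ D ≋ 1
      to a^D≋1 = begin
        (a ^ k) ^ D ≡⟨ ^-comm a k D ⟩
        (a ^ D) ^ k ≈⟨ ^-cong-≋ k a^D≋1 ⟩
        1 ^ k       ≡⟨ ^-zeroˡ k ⟩
        1           ∎
      from : (a ^ k) ^ D ≋ 1 → a ^ D ≋ 1
      from [a^k]^D≋1 = ^≋1-coprime m⊥k [a^D]^m≋1 [a^D]^k≋1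
        where
        [a^D]^k≋1 : (a ^ D) ^ k ≋ 1
        [a^D]^k≋1 = ≋-trans (≡⇒≋ (^-comm a D k)) [a^k]^D≋1
        a≉0 : ¬ a ≋ 0
        a≉0 a≋0 = 1≉0 1<p (≋-trans (≋-sym [a^D]^k≋1) (begin
          (a ^ D) ^ k ≈⟨ ^-cong-≋ k (^-cong-≋ D a≋0) ⟩
          (0 ^ D) ^ k ≡⟨ cong (_^ k) (0^n≡0 D) ⟩
          0 ^ k       ≡⟨ 0^n≡0 k ⟩
          0           ∎))
        [a^D]^m≋1 : (a ^ D) ^ m ≋ 1
        [a^D]^m≋1 = begin
          (a ^ D) ^ m   ≡⟨ ^-*-assoc a D m ⟩
          a ^ (D * m)   ≡⟨ cong (a ^_) D*m≡p-1 ⟩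
          a ^ (p ∸ 1)   ≈⟨ fermat-little p-prime (a≉0 ∘ ∣⇒≋0) ⟩
          1             ∎

    ~-preserves-^D≋1 : ∀ {x y} → x ~ y → toℕ x ^ D ≋ 1 → toℕ y ^ D ≋ 1
    ~-preserves-^D≋1 =
      Equivalence.to ∘ ~-invariant (λ a → a ^ D ≋ 1) (λ a≋b → ≋-trans (^-cong-≋ D (≋-sym a≋b))) ^D≋1-invariant

    ¬∀[≋0-or-^D≋1] : ¬ (∀ y → toℕ y ≋ 0 ⊎ toℕ y ^ D ≋ 1)
    ¬∀[≋0-or-^D≋1] ≋0-or-^D≋1 = ¬∀[y≤n]d∣y^D∸1 1<p 0<D D<p-1 p∣t^D∸1
      where
      p∣0^D∸1 : p ∣ 0 ^ D ∸ 1
      p∣0^D∸1 = subst (λ z → p ∣ z ∸ 1) (sym (0^n≡0 D)) (p ∣0)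
      p∣y^D∸1 : ∀ y → p ∣ toℕ y ^ D ∸ 1
      p∣y^D∸1 y with ≋0-or-^D≋1 y
      ... | inj₁ y≋0   = subst (λ t → p ∣ t ^ D ∸ 1) (sym (<-≋⇒≡ (toℕ<n y) (>-nonZero⁻¹ p) y≋0)) p∣0^D∸1
      ... | inj₂ y^D≋1 = ≋⇒∣∸ (≋-sym y^D≋1)
      p∣t^D∸1 : ∀ t → t ≤ p ∸ 1 → p ∣ t ^ D ∸ 1
      p∣t^D∸1 t t≤p-1 = subst (λ t → p ∣ t ^ D ∸ 1) (toℕ-fromℕ< t<p) (p∣y^D∸1 (fromℕ< t<p))
        where
        t<p : t < p
        t<p = m≤pred[n]⇒suc[m]≤n t≤p-1

    ¬two-components : ¬ HasExactlyTwoComponents p k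
    ¬two-components with ¬∀⟶∃¬ p _ (λ y → (toℕ y ≋? 0) ⊎-dec (toℕ y ^ D ≋? 1)) ¬∀[≋0-or-^D≋1]
    ... | y , y∉ = ¬two-components-of-three 0≁1 0≁y 1≁y
      where
      0≁y : ¬ vertex 0 ~ y
      0≁y 0~y = y∉ (inj₁ (~-preserves-≋0 0~y (vertex-≋ 0)))
      1≁y : ¬ vertex 1 ~ y
      1≁y 1~y = y∉ (inj₂ (~-preserves-^D≋1 1~y (≋-trans (^-cong-≋ D (vertex-≋ 1)) (≡⇒≋ (^-zeroˡ D)))))

∏-nonZero : ∀ ℓ (f : Fin ℓ → ℕ) → (∀ i → NonZero (f i)) → NonZero (∏ ℓ f)
∏-nonZero zero    f _     = _
∏-nonZero (suc ℓ) f f≢0 = m*n≢0 (f zero) (∏ ℓ (f ∘ suc)) {{f≢0 zero}} {{∏-nonZero ℓ (f ∘ suc) (f≢0 ∘ suc)}}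

two-components⇔smooth : ∀ {p} .{{_ : NonZero p}} → Prime p → ∀ {k ℓ} (r a : Fin ℓ → ℕ) →
  (∀ i → Prime (r i)) → (∀ i → 1 ≤ a i) → k ≡ ∏ ℓ (λ i → r i ^ a i) →
  HasExactlyTwoComponents p k ⇔ (Σ[ β ∈ (Fin ℓ → ℕ) ] p ∸ 1 ≡ ∏ ℓ (λ i → r i ^ β i))
two-components⇔smooth {p} p-prime {k} {ℓ} r a r-prime 1≤a k≡∏ = mk⇔ smooth two
  where
  instance
    k≢0 : NonZero k
    k≢0 = subst NonZero (sym k≡∏) (∏-nonZero ℓ _ (λ i → m^n≢0 (r i) (a i) {{prime⇒nonZero (r-prime i)}}))
  open Graph p-prime k
  1<r : ∀ i → 1 < r i
  1<r i = nonTrivial⇒n>1 (r i) {{prime⇒nonTrivial (r-prime i)}}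
  two : (Σ[ β ∈ (Fin ℓ → ℕ) ] p ∸ 1 ≡ ∏ ℓ (λ i → r i ^ β i)) → HasExactlyTwoComponents p k
  two (β , p-1≡∏) with ∏-^-∣ r a β 1≤a
  ... | M , ∏∣kᴹ = two-components M (subst₂ (λ x y → x ∣ y ^ M) (sym p-1≡∏) (sym k≡∏) ∏∣kᴹ)
  smooth : HasExactlyTwoComponents p k → Σ[ β ∈ (Fin ℓ → ℕ) ] p ∸ 1 ≡ ∏ ℓ (λ i → r i ^ β i)
  smooth two-comps with factor-out-∏ r 1<r (p ∸ 1) (m<n⇒0<n∸m 1<p)
  ... | β , zero , _ , _ , ()
  ... | β , suc zero , p-1≡∏*1 , _ , _ = β , trans p-1≡∏*1 (*-identityʳ _)
  ... | β , m@(suc (suc _)) , p-1≡∏*m , r∤m , _ =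
    contradiction two-comps (¬two-components {∏ ℓ (λ i → r i ^ β i)} (sym p-1≡∏*m) (s≤s (s≤s z≤n)) m⊥k)
    where
    m⊥k : Coprime m k
    m⊥k = subst (Coprime m) (sym k≡∏) (coprime-∏ ℓ _ (λ i → coprime-^ (a i) (∤-prime⇒coprime (r-prime i) (r∤m i))))

mainTheorem7 : (p : ℕ) .{{_ : NonZero p}} → Prime p → ¬ (2 ∣ p) →
    (k ℓ α₀ : ℕ) (q α : Fin ℓ → ℕ) →
    ((i : Fin ℓ) → Prime (q i)) →
    ((i : Fin ℓ) → ¬ (2 ∣ q i)) →
    ((i j : Fin ℓ) → q i ≡ q j → i ≡ j) →
    1 ≤ α₀ →
    ((i : Fin ℓ) → 1 ≤ α i) →
    k ≡ 2 ^ α₀ * ∏ ℓ (λ i → q i ^ α i) →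
    (HasExactlyTwoComponents p k
      ⇔ (Σ[ β₀ ∈ ℕ ] Σ[ β ∈ (Fin ℓ → ℕ) ] (p ∸ 1 ≡ 2 ^ β₀ * ∏ ℓ (λ i → q i ^ β i))))
-- The product
-- over 2 ∷ q unfolds definitionally to 2 ^ _ * ∏ over q, so the equations transfer as they are.
mainTheorem7 p p-prime _ k ℓ α₀ q α q-prime _ _ 1≤α₀ 1≤α k≡ = mk⇔
  (λ two → let (β , eq) = to two in β zero , β ∘ suc , eq)
  (λ (β₀ , β , eq) → from (β₀ ∷ β , eq))
  where
  r-prime : ∀ i → Prime ((2 ∷ q) i)
  r-prime zero    = prime[2]
  r-prime (suc i) = q-prime i
  1≤a : ∀ i → 1 ≤ (α₀ ∷ α) i
  1≤a zero    = 1≤α₀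
  1≤a (suc i) = 1≤α i
  open Equivalence (two-components⇔smooth p-prime (2 ∷ q) (α₀ ∷ α) r-prime 1≤a k≡)
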